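{- Let $P=(G,v_s,V_g)$ where $G=(V,E,c,\Theta)$ is an estimated weighted digraph, $v_s\in V$ and $V_g\subset V$. Run the algorithm BEAST (described in the context) on $P$ with a threshold $u_{prune}\ge U^*$. If a solution exists for $P$, BEAST returns a path $\pi$ from $v_s$ to a node of $V_g$ with $u_{\Theta(\pi)}=U^*$, together with the value $U^*$. If no solution exists, BEAST returns $(\emptyset,\infty)$.
   Context: EWDG: $G=(V,E,c,\Theta)$, with $c:E\to\mathbb{R}^+$ unobservable and $\Theta$ mapping each edge $e$ to a finite non-empty sequence of estimators $\theta_e^1,\dots,\theta_e^{k(e)}$ (each of finite running time), where $\theta_e^i$ returns $(l_e^i,u_e^i)$ with $0\le l_e^i\le c(e)\le u_e^i<\infty$ and $[l_e^j,u_e^j]\subseteq[l_e^i,u_e^i]$ for $i<j$. Tightest bounds: $u_{\Theta(e)}:=u_e^{k(e)}$, and $u_{\Theta(\pi)}:=\sum_{e\in\pi}u_{\Theta(e)}$ for a path $\pi$. A solution is a path from $v_s$ to a node in $V_g$; $U^*:=\min\{u_{\Theta(\pi)}:\pi\text{ a solution}\}$ (with $U^*=\infty$ if no solution exists). Algorithm BEAST (input $P$, parameter $u_{prune}$): set $g_u(v_s)=0$, OPEN $=\{v_s\}$ (key $g_u$), CLOSED $=\emptyset$. While OPEN is non-empty: pop $n$ from OPEN with minimal $g_u(n)$; if $n\in V_g$, return the path obtained by following parent pointers from $n$ back to $v_s$, together with $g_u(n)$. Otherwise insert $n$ into CLOSED, and for each successor $s$ of $n$ (edge $e=(n,s)$):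 if $s\notin$ OPEN $\cup$ CLOSED set $g_u(s)=\infty$; set $l(e)=0,u(e)=0$; while $g_u(n)+l(e)<g_u(s)$ and $g_u(n)+l(e)\le u_{prune}$ and estimators remain for $e$, apply the next estimator of $e$ (starting from $\theta_e^1$) and set $(l(e),u(e))$ to its output; then let $\tilde g=g_u(n)+u(e)$; if $\tilde g<g_u(s)$ and $\tilde g\le u_{prune}$, set $g_u(s)=\tilde g$, remove $s$ from OPEN if present, and insert $s$ into OPEN with key $g_u(s)$ and parent $n$. If OPEN becomes empty, return $(\emptyset,\infty)$.
   Formalization: The edge costs $c$, the estimator bounds and the threshold $u_{prune}$ are rational (the threshold may also be ∞) instead of real. -}

module Defs where

open import Data.Nat using (ℕ)
open import Data.Bool using (Bool; true; false; _∧_; _∨_; if_then_else_; not)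
open import Data.Fin using (Fin; _≟_)
open import Data.Fin.Subset using (Subset; _∈_; _∉_)
open import Data.List using (List; []; _∷_; _∷ʳ_; allFin; filterᵇ)
open import Data.List.NonEmpty using (List⁺; toList; last)
open import Data.List.Relation.Unary.All using (All)
open import Data.List.Relation.Unary.AllPairs using (AllPairs)
open import Data.List.Relation.Binary.Permutation.Propositional using (_↭_)
open import Data.Maybe using (Maybe; just; nothing; is-just; maybe)
open import Data.Product using (_×_; _,_; proj₁; proj₂; ∃; ∃-syntax)
open import Data.Sum using (_⊎_)
open import Data.Rational using (ℚ; 0ℚ; _+_; _≤_; _<_)
open import Data.Rational.Properties using (_≤?_; _<?_)
open import Relation.Nullary using (¬_)
open import Relation.Nullary.Decidable using (⌊_⌋)
open import Relation.Binary.PropositionalEquality using (_≡_; _≢_)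

data ℚ∞ : Set where
  fin : ℚ → ℚ∞
  ∞   : ℚ∞

infix 4 _≤∞_ _<∞_

data _≤∞_ : ℚ∞ → ℚ∞ → Set where
  fin≤fin : ∀ {p q} → p ≤ q → fin p ≤∞ fin q
  _≤∞∞    : ∀ x → x ≤∞ ∞

data _<∞_ : ℚ∞ → ℚ∞ → Set where
  fin<fin : ∀ {p q} → p < q → fin p <∞ fin q
  fin<∞   : ∀ p → fin p <∞ ∞

leqᵇ : ℚ∞ → ℚ∞ → Bool
leqᵇ (fin p) (fin q) = ⌊ p ≤? q ⌋
leqᵇ ∞       (fin q) = false
leqᵇ _       ∞       = true

ltᵇ : ℚ∞ → ℚ∞ → Bool
ltᵇ (fin p) (fin q) = ⌊ p <? q ⌋
ltᵇ (fin p) ∞       = true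
ltᵇ ∞       _       = false

-- Estimated weighted digraph on the finite node set V = Fin n.
-- Θ a b = nothing  : no edge (a,b)
-- Θ a b = just θs  : edge (a,b) with the non-empty sequence of estimator
--                    outputs θs = (l¹,u¹),…,(lᵏ,uᵏ) (in application order).

record EWDG (n : ℕ) : Set where
  field
    Θ      : Fin n → Fin n → Maybe (List⁺ (ℚ × ℚ))
    c      : Fin n → Fin n → ℚ   -- unobservable true cost (meaningful on edges)
    c-pos  : ∀ a b θs → Θ a b ≡ just θs → 0ℚ < c a b
    bounds : ∀ a b θs → Θ a b ≡ just θs →
             All (λ lu → 0ℚ ≤ proj₁ lu × proj₁ lu ≤ c a b × c a b ≤ proj₂ lu) (toList θs)
    nested : ∀ a b θs → Θ a b ≡ just θs →
             AllPairs (λ i j → proj₁ i ≤ proj₁ j × proj₂ j ≤ proj₂ i) (toList θs)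

module _ {n : ℕ} (G : EWDG n) where
  open EWDG G

  Edge : Fin n → Fin n → Set
  Edge a b = ∃[ θs ] (Θ a b ≡ just θs)

  -- tightest upper bound u_{Θ(e)} (0 if there is no edge; never used then)
  uΘ : Fin n → Fin n → ℚ
  uΘ a b = maybe (λ θs → proj₂ (last θs)) 0ℚ (Θ a b)

  uΘpath : List (Fin n) → ℚ
  uΘpath (a ∷ b ∷ π) = uΘ a b + uΘpath (b ∷ π)
  uΘpath _           = 0ℚ

  data PathFromTo : Fin n → Fin n → List (Fin n) → Set where
    single : ∀ a → PathFromTo a a (a ∷ [])
    cons   : ∀ {a b v π} → Edge a b → PathFromTo b v π → PathFromTo a v (a ∷ π)

  Solution : Fin n → Subset n → List (Fin n) → Set
  Solution vs Vg π = ∃[ v ] (PathFromTo vs v π × v ∈ Vg)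

  IsUStar : Fin n → Subset n → ℚ∞ → Set
  IsUStar vs Vg U =
      (∃[ π ] (Solution vs Vg π × U ≡ fin (uΘpath π) ×
                (∀ π' → Solution vs Vg π' → uΘpath π ≤ uΘpath π')))
    ⊎ (U ≡ ∞ × (∀ π → ¬ Solution vs Vg π))

-- The algorithm BEAST as a (nondeterministic) transition system.
-- Nondeterminism: tie-breaking among OPEN nodes of minimal key and the
-- order in which successors are processed.

module BEAST {n : ℕ} (G : EWDG n) (vs : Fin n) (Vg : Subset n) (uprune : ℚ∞) where
  open EWDG G

  record State : Set where
    field
      open?   : Fin n → Bool
      closed? : Fin n → Bool
      g       : Fin n → ℚ∞
      parent  : Fin n → Maybe (Fin n)
  open State

  Output : Set
  Output = List (Fin n) × ℚ∞

  data Config : Set where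
    select : State → Config                              -- top of the while loop
    expand : State → Fin n → ℚ → List (Fin n) → Config   -- expanding n (g_u(n)=q), successors still to process
    done   : Output → Config

  successors : Fin n → List (Fin n)
  successors v = filterᵇ (λ s → is-just (Θ v s)) (allFin n)

  -- inner while loop: gn = g_u(n), gs = g_u(s), current (l(e),u(e)),
  -- remaining estimators; returns final u(e)
  refine : ℚ → ℚ∞ → ℚ → ℚ → List (ℚ × ℚ) → ℚ
  refine gn gs l u []              = u
  refine gn gs l u ((l' , u') ∷ θs) =
    if ltᵇ (fin (gn + l)) gs ∧ leqᵇ (fin (gn + l)) uprune
    then refine gn gs l' u' θs
    else u

  update : {A : Set} → Fin n → A → (Fin n → A) → Fin n → A
  update s a f x = if ⌊ x ≟ s ⌋ then a else f x

  process : State → Fin n → ℚ → Fin n → State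
  process st v q s =
    let gs  = if open? st s ∨ closed? st s then g st s else ∞
        g₀  = update s gs (g st)
        ue  = maybe (λ θs → refine q gs 0ℚ 0ℚ (toList θs)) 0ℚ (Θ v s)
        g~  = q + ue
    in if ltᵇ (fin g~) gs ∧ leqᵇ (fin g~) uprune
       then record st { open? = update s true (open? st)
                      ; g = update s (fin g~) g₀
                      ; parent = update s (just v) (parent st) }
       else record st { g = g₀ }

  data Trace (par : Fin n → Maybe (Fin n)) : Fin n → List (Fin n) → Set where
    at-start : Trace par vs (vs ∷ [])
    via      : ∀ {v p π} → v ≢ vs → par v ≡ just p → Trace par p π →
               Trace par v (π ∷ʳ v)

  MinOpen : State → Fin n → Set
  MinOpen st v = open? st v ≡ true × (∀ w → open? st w ≡ true → g st v ≤∞ g st w)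

  infix 4 _⟶_
  data _⟶_ : Config → Config → Set where
    pop-goal : ∀ {st v q π} → MinOpen st v → g st v ≡ fin q → v ∈ Vg →
               Trace (parent st) v π →
               select st ⟶ done (π , fin q)
    pop-expand : ∀ {st v q order} → MinOpen st v → g st v ≡ fin q → v ∉ Vg →
               order ↭ successors v →
               select st ⟶ expand (record st { open?   = update v false (open? st)
                                             ; closed? = update v true (closed? st) })
                                  v q order
    step     : ∀ {st v q s order} →
               expand st v q (s ∷ order) ⟶ expand (process st v q s) v q order
    end-expand : ∀ {st v q} → expand st v q [] ⟶ select st
    fail     : ∀ {st} → (∀ w → open? st w ≡ false) → select st ⟶ done ([] , ∞)

  initial : Config
  initial = select (record
    { open?   = λ w → ⌊ w ≟ vs ⌋
    ; closed? = λ _ → false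
    ; g       = λ w → if ⌊ w ≟ vs ⌋ then fin 0ℚ else ∞
    ; parent  = λ _ → nothing })

{-# OPTIONS --safe #-}
-- BEAST is Dijkstra's algorithm on the tightest upper bounds u_Θ, with pruning at u_prune. The
-- refinement loop either reaches the tightest bound of an edge or stops at a lower bound that
-- already fails the improvement test, which the tightest bound then fails as well; so every
-- relaxation decides as Dijkstra's would with the weights u_Θ. Hence the Dijkstra invariants
-- hold: keys of closed nodes are at most those of open nodes, edges leaving closed nodes are
-- relaxed up to pruning, and parent pointers trace paths whose u_Θ-cost is at most the key.
-- Consequently every optimal solution carries an open node of key at most U* ≤ u_prune, so the
-- first goal popped has key U* and OPEN cannot run empty while a solution exists. A closed node
-- is never reopened, so each expansion closes a new node, which bounds the run.

module Submission where

open import Defs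
open import Data.Nat using (ℕ)
open import Data.Fin using (Fin)
open import Data.Fin.Subset using (Subset)
open import Data.List using (List; [])
open import Data.Product using (_×_; _,_; ∃; ∃-syntax)
open import Data.Sum using (_⊎_)
open import Function using (flip; _∘_; id)
open import Induction.WellFounded using (Acc)
open import Relation.Nullary using (¬_)
open import Relation.Binary.PropositionalEquality using (_≡_)
open import Relation.Binary.Construct.Closure.ReflexiveTransitive using (Star)

open import Data.Bool using (true; false; _∧_; _∨_; if_then_else_; T)
import Data.Bool as Bool
open import Data.Bool.Properties using (not-¬; ¬-not)
open import Data.Empty using (⊥-elim)
import Data.Fin as Fin
open import Data.Fin using (_≟_)
open import Data.Fin.Subset using (_∈_; _∉_; _⊃_)
open import Data.Fin.Subset.Induction using (⊃-wellFounded)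
open import Data.Fin.Subset.Properties using (_∈?_)
open import Data.List using (_∷_; _∷ʳ_; initLast; _∷ʳ′_; allFin)
open import Data.List.Membership.Propositional using () renaming (_∈_ to _∈ˡ_)
open import Data.List.Membership.Propositional.Properties using (∈-filter⁺; ∈-filter⁻; ∈-allFin)
open import Data.List.NonEmpty using (List⁺; toList; last) renaming (_∷_ to _∷⁺_)
open import Data.List.Relation.Binary.Permutation.Propositional using (_↭_; ↭-refl; ↭-sym)
open import Data.List.Relation.Binary.Permutation.Propositional.Properties using (∈-resp-↭)
open import Data.List.Relation.Unary.All as All using (All; []; _∷_)
open import Data.List.Relation.Unary.Any using (here; there)
open import Data.Maybe using (just; nothing; maybe; is-just)
open import Data.Maybe.Properties using (just-injective)
import Data.Nat as ℕ
open import Data.Product using (proj₁; proj₂)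
open import Data.Rational using (ℚ; 0ℚ; _+_; _≤_; _<_)
open import Data.Rational.Properties
  using (_≤?_; _<?_; ≤-refl; ≤-trans; ≤-total; <⇒≤; ≮⇒≥; <-≤-trans; ≤-<-trans; <-irrefl; ≤-antisym;
         +-identityˡ; +-identityʳ; +-assoc; +-monoˡ-≤; +-monoʳ-≤)
open import Data.Sum using (inj₁; inj₂; [_,_]′)
open import Data.Unit using (tt)
open import Data.Vec using (tabulate)
open import Data.Vec.Properties using (tabulate-cong; lookup∘tabulate; []=⇒lookup; lookup⇒[]=)
open import Function using (_∘_; id)
open import Induction.WellFounded using (acc)
open import Relation.Binary.Construct.Closure.ReflexiveTransitive using (fold)
open import Relation.Binary.PropositionalEquality
  using (refl; sym; trans; cong; subst; subst₂; _≢_; module ≡-Reasoning)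
open import Relation.Nullary using (Dec; yes; no)
open import Relation.Nullary.Decidable using (⌊_⌋; T?)
open import Relation.Nullary.Reflects using (Reflects; ofʸ; ofⁿ; _×-reflects_)
open import Relation.Unary using (Pred; Decidable)

module _ {a} {A : Set a} where

  last-∷ : (x y : A) (ys : List A) → last (x ∷⁺ y ∷ ys) ≡ last (y ∷⁺ ys)
  last-∷ x y ys with initLast ys
  ... | []       = refl
  ... | zs ∷ʳ′ z = refl

  All-last : ∀ {p} {P : Pred A p} (xs : List⁺ A) → All P (toList xs) → P (last xs)
  All-last         (x ∷⁺ [])     (px ∷ [])  = px
  All-last {P = P} (x ∷⁺ y ∷ ys) (_  ∷ pys) = subst P (sym (last-∷ x y ys)) (All-last (y ∷⁺ ys) pys)

p≤p+q : ∀ p {q} → 0ℚ ≤ q → p ≤ p + q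
p≤p+q p 0≤q = subst (_≤ p + _) (+-identityʳ p) (+-monoʳ-≤ p 0≤q)

infixl 6 _⊕_

_⊕_ : ℚ∞ → ℚ → ℚ∞
fin p ⊕ q = fin (p + q)
∞     ⊕ q = ∞

fin-≤⁻ : ∀ {p q} → fin p ≤∞ fin q → p ≤ q
fin-≤⁻ (fin≤fin p≤q) = p≤q

≤∞-refl : ∀ {x} → x ≤∞ x
≤∞-refl {fin p} = fin≤fin ≤-refl
≤∞-refl {∞}     = ∞ ≤∞∞

≤∞-reflexive : ∀ {x y} → x ≡ y → x ≤∞ y
≤∞-reflexive refl = ≤∞-refl

≤∞-trans : ∀ {x y z} → x ≤∞ y → y ≤∞ z → x ≤∞ z
≤∞-trans (fin≤fin p≤q) (fin≤fin q≤r) = fin≤fin (≤-trans p≤q q≤r)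
≤∞-trans {x} _         (_ ≤∞∞)       = x ≤∞∞

≤∞-total : ∀ x y → x ≤∞ y ⊎ y ≤∞ x
≤∞-total (fin p) (fin q) with ≤-total p q
... | inj₁ p≤q = inj₁ (fin≤fin p≤q)
... | inj₂ q≤p = inj₂ (fin≤fin q≤p)
≤∞-total x       ∞       = inj₁ (x ≤∞∞)
≤∞-total ∞       y       = inj₂ (y ≤∞∞)

<∞⇒≤∞ : ∀ {x y} → x <∞ y → x ≤∞ y
<∞⇒≤∞ (fin<fin p<q) = fin≤fin (<⇒≤ p<q)
<∞⇒≤∞ (fin<∞ p)     = fin p ≤∞∞

<∞⇒≱∞ : ∀ {x y} → x <∞ y → ¬ y ≤∞ x
<∞⇒≱∞ (fin<fin p<q) (fin≤fin q≤p) = <-irrefl refl (<-≤-trans p<q q≤p)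

≮∞⇒≥∞ : ∀ {x y} → ¬ x <∞ y → y ≤∞ x
≮∞⇒≥∞ {fin p} {fin q} x≮y = fin≤fin (≮⇒≥ (λ p<q → x≮y (fin<fin p<q)))
≮∞⇒≥∞ {fin p} {∞}     x≮y = ⊥-elim (x≮y (fin<∞ p))
≮∞⇒≥∞ {∞}     {y}     _   = y ≤∞∞

≤∞-<∞-trans : ∀ {x y z} → x ≤∞ y → y <∞ z → x <∞ z
≤∞-<∞-trans (fin≤fin p≤q) (fin<fin q<r) = fin<fin (≤-<-trans p≤q q<r)
≤∞-<∞-trans (fin≤fin _)   (fin<∞ _)     = fin<∞ _

<∞-≤∞-trans : ∀ {x y z} → x <∞ y → y ≤∞ z → x <∞ z
<∞-≤∞-trans (fin<fin p<q) (fin≤fin q≤r) = fin<fin (<-≤-trans p<q q≤r)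
<∞-≤∞-trans (fin<fin _)   (_ ≤∞∞)       = fin<∞ _
<∞-≤∞-trans (fin<∞ p)     (_ ≤∞∞)       = fin<∞ p

⊕-monoˡ-≤∞ : ∀ {x y} q → x ≤∞ y → x ⊕ q ≤∞ y ⊕ q
⊕-monoˡ-≤∞ q (fin≤fin p≤p′) = fin≤fin (+-monoˡ-≤ q p≤p′)
⊕-monoˡ-≤∞ q (x ≤∞∞)        = (x ⊕ q) ≤∞∞

⊕-monoʳ-≤∞ : ∀ x {q r} → q ≤ r → x ⊕ q ≤∞ x ⊕ r
⊕-monoʳ-≤∞ (fin p) q≤r = fin≤fin (+-monoʳ-≤ p q≤r)
⊕-monoʳ-≤∞ ∞       _   = ∞ ≤∞∞

x≤∞x⊕q : ∀ x {q} → 0ℚ ≤ q → x ≤∞ x ⊕ q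
x≤∞x⊕q (fin p) 0≤q = fin≤fin (p≤p+q p 0≤q)
x≤∞x⊕q ∞       _   = ∞ ≤∞∞

ltᵇ-reflects : ∀ x y → Reflects (x <∞ y) (ltᵇ x y)
ltᵇ-reflects (fin p) (fin q) with p <? q
... | yes p<q = ofʸ (fin<fin p<q)
... | no  p≮q = ofⁿ λ { (fin<fin p<q) → p≮q p<q }
ltᵇ-reflects (fin p) ∞       = ofʸ (fin<∞ p)
ltᵇ-reflects ∞       y       = ofⁿ λ ()

leqᵇ-reflects : ∀ x y → Reflects (x ≤∞ y) (leqᵇ x y)
leqᵇ-reflects (fin p) (fin q) with p ≤? q
... | yes p≤q = ofʸ (fin≤fin p≤q)
... | no  p≰q = ofⁿ λ { (fin≤fin p≤q) → p≰q p≤q }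
leqᵇ-reflects (fin p) ∞       = ofʸ (fin p ≤∞∞)
leqᵇ-reflects ∞       (fin q) = ofⁿ λ ()
leqᵇ-reflects ∞       ∞       = ofʸ (∞ ≤∞∞)

argmin-or-empty : ∀ {n p} {P : Pred (Fin n) p} → Decidable P → (f : Fin n → ℚ∞) →
                  (∀ w → ¬ P w) ⊎ ∃ λ v → P v × (∀ w → P w → f v ≤∞ f w)
argmin-or-empty {ℕ.zero}  P? f = inj₁ λ ()
argmin-or-empty {ℕ.suc n} P? f with argmin-or-empty (P? ∘ Fin.suc) (f ∘ Fin.suc) | P? Fin.zero
... | inj₁ none           | no ¬P0 = inj₁ λ { Fin.zero → ¬P0 ; (Fin.suc w) → none w }
... | inj₁ none           | yes P0 =
  inj₂ (Fin.zero , P0 , λ { Fin.zero _ → ≤∞-refl ; (Fin.suc w) Pw → ⊥-elim (none w Pw) })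
... | inj₂ (v , Pv , min) | no ¬P0 =
  inj₂ (Fin.suc v , Pv , λ { Fin.zero P0 → ⊥-elim (¬P0 P0) ; (Fin.suc w) → min w })
... | inj₂ (v , Pv , min) | yes P0 with ≤∞-total (f Fin.zero) (f (Fin.suc v))
...   | inj₁ f0≤fv =
  inj₂ (Fin.zero , P0 , λ { Fin.zero _ → ≤∞-refl ; (Fin.suc w) Pw → ≤∞-trans f0≤fv (min w Pw) })
...   | inj₂ fv≤f0 = inj₂ (Fin.suc v , Pv , λ { Fin.zero _ → fv≤f0 ; (Fin.suc w) → min w })

module _ {n} (G : EWDG n) where
  open EWDG G using (Θ; c; c-pos; bounds)

  uΘ-≡ : ∀ {a b θs} → Θ a b ≡ just θs → uΘ G a b ≡ proj₂ (last θs)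
  uΘ-≡ Θab≡ = cong (maybe (λ θs → proj₂ (last θs)) 0ℚ) Θab≡

  c≤tightest : ∀ {a b θs} → Θ a b ≡ just θs → c a b ≤ proj₂ (last θs)
  c≤tightest {a} {b} {θs} Θab≡ = proj₂ (proj₂ (All-last θs (bounds a b θs Θab≡)))

  0≤tightest : ∀ {a b θs} → Θ a b ≡ just θs → 0ℚ ≤ proj₂ (last θs)
  0≤tightest {a} {b} {θs} Θab≡ = ≤-trans (<⇒≤ (c-pos a b θs Θab≡)) (c≤tightest Θab≡)

  uΘ-nonneg : ∀ {a b} → Edge G a b → 0ℚ ≤ uΘ G a b
  uΘ-nonneg (_ , Θab≡) = subst (0ℚ ≤_) (sym (uΘ-≡ Θab≡)) (0≤tightest Θab≡)

  uΘpath-∷ : ∀ {a b t π} → PathFromTo G b t π → uΘpath G (a ∷ π) ≡ uΘ G a b + uΘpath G π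
  uΘpath-∷ (single _) = refl
  uΘpath-∷ (cons _ _) = refl

  uΘpath-nonneg : ∀ {a t π} → PathFromTo G a t π → 0ℚ ≤ uΘpath G π
  uΘpath-nonneg (single _)         = ≤-refl
  uΘpath-nonneg (cons {a} ab path) =
    subst (0ℚ ≤_) (sym (uΘpath-∷ {a} path)) (≤-trans (uΘ-nonneg ab) (p≤p+q _ (uΘpath-nonneg path)))

  path-∷ʳ : ∀ {a b t π} → PathFromTo G a b π → Edge G b t → PathFromTo G a t (π ∷ʳ t)
  path-∷ʳ (single _)    bt = cons bt (single _)
  path-∷ʳ (cons ab path) bt = cons ab (path-∷ʳ path bt)

  uΘpath-∷ʳ : ∀ {a b t π} → PathFromTo G a b π → Edge G b t →
              uΘpath G (π ∷ʳ t) ≡ uΘpath G π + uΘ G b t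
  uΘpath-∷ʳ {t = t} (single a) _ = trans (+-identityʳ (uΘ G a t)) (sym (+-identityˡ (uΘ G a t)))
  uΘpath-∷ʳ {b = b} {t} (cons {a} {a′} {_} {π} _ path) bt = begin
    uΘpath G (a ∷ (π ∷ʳ t))              ≡⟨ uΘpath-∷ (path-∷ʳ path bt) ⟩
    uΘ G a a′ + uΘpath G (π ∷ʳ t)        ≡⟨ cong (uΘ G a a′ +_) (uΘpath-∷ʳ path bt) ⟩
    uΘ G a a′ + (uΘpath G π + uΘ G b t)  ≡⟨ sym (+-assoc (uΘ G a a′) (uΘpath G π) (uΘ G b t)) ⟩
    uΘ G a a′ + uΘpath G π + uΘ G b t    ≡⟨ cong (_+ uΘ G b t) (sym (uΘpath-∷ path)) ⟩
    uΘpath G (a ∷ π) + uΘ G b t          ∎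
    where open ≡-Reasoning

module BEAST-Properties {n} (G : EWDG n) (vs : Fin n) (Vg : Subset n) (uprune : ℚ∞) where
  open EWDG G using (Θ)
  open BEAST G vs Vg uprune
  open State

  update-same : ∀ {A : Set} s (a : A) f → update s a f s ≡ a
  update-same s a f with s ≟ s
  ... | yes _   = refl
  ... | no s≢s = ⊥-elim (s≢s refl)

  update-other : ∀ {A : Set} {s x} (a : A) f → x ≢ s → update s a f x ≡ f x
  update-other {s = s} {x} a f x≢s with x ≟ s
  ... | yes x≡s = ⊥-elim (x≢s x≡s)
  ... | no _    = refl

  -- BEAST applies this test twice when processing an edge (n, s): to continue refining with
  -- x = g_u(n) + l(e), and to accept the update with x = g_u(n) + u(e); y is g_u(s).
  Improves : ℚ∞ → ℚ∞ → Set
  Improves x y = x <∞ y × x ≤∞ uprune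

  improves-reflects : ∀ x y → Reflects (Improves x y) (ltᵇ x y ∧ leqᵇ x uprune)
  improves-reflects x y = ltᵇ-reflects x y ×-reflects leqᵇ-reflects x uprune

  ≤∞-improves : ∀ {x y z} → x ≤∞ y → Improves y z → Improves x z
  ≤∞-improves x≤y (y<z , y≤up) = ≤∞-<∞-trans x≤y y<z , ≤∞-trans x≤y y≤up

  improves-≤∞ : ∀ {x y z} → Improves x y → y ≤∞ z → Improves x z
  improves-≤∞ (x<y , x≤up) y≤z = <∞-≤∞-trans x<y y≤z , x≤up

  ¬improves⇒≥∞ : ∀ {x y} → ¬ Improves x y → x ≤∞ uprune → y ≤∞ x
  ¬improves⇒≥∞ ¬imp x≤up = ≮∞⇒≥∞ (λ x<y → ¬imp (x<y , x≤up))

  Relaxed : State → Fin n → Fin n → Set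
  Relaxed st w s = ¬ Improves (g st w ⊕ uΘ G w s) (g st s)

  -- The refinement loop

  Bounded : ℚ → ℚ × ℚ → Set
  Bounded U lu = proj₁ lu ≤ proj₂ lu × proj₁ lu ≤ U

  SameVerdict : ℚ → ℚ∞ → ℚ → ℚ → Set
  SameVerdict gn gs U r = r ≡ U ⊎ ¬ Improves (fin (gn + r)) gs × ¬ Improves (fin (gn + U)) gs

  -- The loop stops early only at a lower bound l that already fails the test; l lies below both
  -- the returned u and the tightest bound U, so these fail it as well.
  refine-verdict : ∀ gn gs U l u xs → All (Bounded U) ((l , u) ∷ xs) →
                   proj₂ (last ((l , u) ∷⁺ xs)) ≡ U → SameVerdict gn gs U (refine gn gs l u xs)
  refine-verdict gn gs U l u []                _                   u≡U    = inj₁ u≡U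
  refine-verdict gn gs U l u ((l′ , u′) ∷ xs) ((l≤u , l≤U) ∷ bnds) last≡U =
    continue? (improves-reflects (fin (gn + l)) gs)
    where
    continue? : ∀ {b} → Reflects (Improves (fin (gn + l)) gs) b →
                SameVerdict gn gs U (if b then refine gn gs l′ u′ xs else u)
    continue? (ofʸ _)    =
      refine-verdict gn gs U l′ u′ xs bnds (trans (cong proj₂ (sym (last-∷ _ _ xs))) last≡U)
    continue? (ofⁿ ¬imp) = inj₂ ( ¬imp ∘ ≤∞-improves (⊕-monoʳ-≤∞ (fin gn) l≤u)
                                , ¬imp ∘ ≤∞-improves (⊕-monoʳ-≤∞ (fin gn) l≤U))

  edge-verdict : ∀ {a b} gn gs → Edge G a b →
                 SameVerdict gn gs (uΘ G a b) (maybe (λ θs → refine gn gs 0ℚ 0ℚ (toList θs)) 0ℚ (Θ a b))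
  edge-verdict {a} {b} gn gs (θ ∷⁺ θs , Θab≡) rewrite Θab≡ =
    refine-verdict gn gs _ 0ℚ 0ℚ (θ ∷ θs)
      ((≤-refl , 0≤tightest G Θab≡) ∷ All.map bounded (EWDG.bounds G a b _ Θab≡))
      (cong proj₂ (last-∷ _ θ θs))
    where
    bounded : ∀ {lu} → 0ℚ ≤ proj₁ lu × proj₁ lu ≤ EWDG.c G a b × EWDG.c G a b ≤ proj₂ lu →
              Bounded (proj₂ (last (θ ∷⁺ θs))) lu
    bounded (_ , l≤c , c≤u) = ≤-trans l≤c c≤u , ≤-trans l≤c (c≤tightest G Θab≡)

  -- Invariants of the main loop

  Visited : State → Fin n → Set
  Visited st w = open? st w ≡ true ⊎ closed? st w ≡ true

  ParentLink : State → Fin n → Fin n → Set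
  ParentLink st y x = closed? st y ≡ true × Edge G y x × g st y ⊕ uΘ G y x ≤∞ g st x

  record WellFormed (st : State) : Set where
    field
      open⇒¬closed   : ∀ {w} → open? st w ≡ true → closed? st w ≡ false
      visited⇒finite : ∀ {w} → Visited st w → ∃ λ q → g st w ≡ fin q
      unvisited⇒∞    : ∀ {w} → open? st w ≡ false → closed? st w ≡ false → g st w ≡ ∞
      nonneg         : ∀ w → fin 0ℚ ≤∞ g st w
      start-key      : g st vs ≡ fin 0ℚ
      parent-link    : ∀ {x y} → parent st x ≡ just y → ParentLink st y x
      closed⇒∉goal   : ∀ {w} → closed? st w ≡ true → w ∉ Vg
      visited⇒trace  : ∀ {w} → Visited st w → ∃ (Trace (parent st) w)

  module _ {st} (W : WellFormed st) where
    open WellFormed W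

    ≤fin⇒visited : ∀ {w p} → g st w ≤∞ fin p → Visited st w
    ≤fin⇒visited {w} w≤p with open? st w in ow | closed? st w in cw
    ... | true  | _     = inj₁ refl
    ... | false | true  = inj₂ refl
    ... | false | false with () ← subst (_≤∞ fin _) (unvisited⇒∞ ow cw) w≤p

    -- the key of s against which BEAST.process tests
    effective-key : ∀ s → (if open? st s ∨ closed? st s then g st s else ∞) ≡ g st s
    effective-key s with open? st s in os | closed? st s in cs
    ... | true  | _     = refl
    ... | false | true  = refl
    ... | false | false = sym (unvisited⇒∞ os cs)

    trace-path : ∀ {w π} → Trace (parent st) w π → PathFromTo G vs w π × fin (uΘpath G π) ≤∞ g st w
    trace-path at-start = single vs , nonneg vs
    trace-path (via {w} {p} {π} _ par≡ tr) with parent-link par≡ | trace-path tr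
    ... | _ , pw , link | path , cost≤ =
      path-∷ʳ G path pw ,
      subst (_≤∞ g st w) (cong fin (sym (uΘpath-∷ʳ G path pw)))
        (≤∞-trans (⊕-monoˡ-≤∞ _ cost≤) link)

  Trace-transfer : ∀ {par par′ w π} → (∀ {x y} → par x ≡ just y → par′ y ≡ par y) →
                   par′ w ≡ par w → Trace par w π → Trace par′ w π
  Trace-transfer same-above same-at at-start           = at-start
  Trace-transfer same-above same-at (via w≢vs par≡ tr) =
    via w≢vs (trans same-at par≡) (Trace-transfer same-above (same-above par≡) tr)

  record SelectInv (st : State) : Set where
    field
      wf             : WellFormed st
      closed≤open    : ∀ {w x} → closed? st w ≡ true → open? st x ≡ true → g st w ≤∞ g st x
      closed-relaxed : ∀ {w s} → closed? st w ≡ true → Edge G w s → Relaxed st w s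

  record ExpandInv (st : State) (v : Fin n) (q : ℚ) (pending : List (Fin n)) : Set where
    field
      wf             : WellFormed st
      key            : g st v ≡ fin q
      expanded       : closed? st v ≡ true
      closed≤key     : ∀ {w} → closed? st w ≡ true → g st w ≤∞ fin q
      key≤open       : ∀ {x} → open? st x ≡ true → fin q ≤∞ g st x
      closed-relaxed : ∀ {w s} → closed? st w ≡ true → Edge G w s →
                       w ≡ v × s ∈ˡ pending ⊎ Relaxed st w s
      pending-edge   : ∀ {s} → s ∈ˡ pending → Edge G v s

  initial-state : State
  initial-state = record
    { open?   = λ w → ⌊ w ≟ vs ⌋
    ; closed? = λ _ → false
    ; g       = update vs (fin 0ℚ) (λ _ → ∞)
    ; parent  = λ _ → nothing }

  initial-inv : SelectInv initial-state
  initial-inv = record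
    { wf = record
      { open⇒¬closed   = λ _ → refl
      ; visited⇒finite = finite
      ; unvisited⇒∞    = unvisited
      ; nonneg         = nonneg
      ; start-key      = update-same vs (fin 0ℚ) (λ _ → ∞)
      ; parent-link    = λ ()
      ; closed⇒∉goal   = λ ()
      ; visited⇒trace  = trace }
    ; closed≤open    = λ ()
    ; closed-relaxed = λ () }
    where
    open State initial-state using () renaming (open? to open₀; g to g₀)
    finite : ∀ {w} → Visited initial-state w → ∃ λ q → g₀ w ≡ fin q
    finite {w} (inj₁ o) with w ≟ vs
    finite (inj₁ _)  | yes _ = 0ℚ , refl
    finite (inj₁ ()) | no _
    unvisited : ∀ {w} → open₀ w ≡ false → false ≡ false → g₀ w ≡ ∞
    unvisited {w} o _ with w ≟ vs
    unvisited ()  _ | yes _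
    unvisited _   _ | no _ = refl
    nonneg : ∀ w → fin 0ℚ ≤∞ g₀ w
    nonneg w with w ≟ vs
    ... | yes _ = ≤∞-refl
    ... | no _  = fin 0ℚ ≤∞∞
    trace : ∀ {w} → Visited initial-state w → ∃ (Trace (λ _ → nothing) w)
    trace {w} (inj₁ o) with w ≟ vs
    trace (inj₁ _)  | yes refl = _ , at-start
    trace (inj₁ ()) | no _

  close : State → Fin n → State
  close st v = record st { open? = update v false (open? st) ; closed? = update v true (closed? st) }

  module Closing (st : State) (v : Fin n) where

    open-after-close : ∀ {x} → open? (close st v) x ≡ true → x ≢ v × open? st x ≡ true
    open-after-close {x} o with x ≟ v
    open-after-close ()  | yes _
    open-after-close o   | no x≢v = x≢v , o

    closed-after-close : ∀ {x} → closed? (close st v) x ≡ true → x ≡ v ⊎ closed? st x ≡ true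
    closed-after-close {x} c with x ≟ v
    ... | yes x≡v = inj₁ x≡v
    ... | no _    = inj₂ c

    closed-before-close : ∀ {x} → closed? st x ≡ true → closed? (close st v) x ≡ true
    closed-before-close {x} c with x ≟ v
    ... | yes _ = refl
    ... | no _  = c

    visited-after-close : open? st v ≡ true → ∀ {x} → Visited (close st v) x → Visited st x
    visited-after-close ov (inj₁ o) = inj₁ (proj₂ (open-after-close o))
    visited-after-close ov (inj₂ c) with closed-after-close c
    ... | inj₁ refl = inj₁ ov
    ... | inj₂ c′   = inj₂ c′

    close-wf : WellFormed st → open? st v ≡ true → v ∉ Vg → WellFormed (close st v)
    close-wf W ov v∉Vg = record
      { open⇒¬closed   = λ o → let x≢v , o′ = open-after-close o in
                                 trans (update-other true (closed? st) x≢v) (open⇒¬closed o′)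
      ; visited⇒finite = visited⇒finite ∘ visited-after-close ov
      ; unvisited⇒∞    = unvisited
      ; nonneg         = nonneg
      ; start-key      = start-key
      ; parent-link    = λ par≡ → let cy , link = parent-link par≡ in closed-before-close cy , link
      ; closed⇒∉goal   = closed∉goal
      ; visited⇒trace  = visited⇒trace ∘ visited-after-close ov }
      where
      open WellFormed W
      unvisited : ∀ {x} → open? (close st v) x ≡ false → closed? (close st v) x ≡ false → g st x ≡ ∞
      unvisited {x} o c with x ≟ v
      unvisited o () | yes _
      unvisited o c  | no _ = unvisited⇒∞ o c
      closed∉goal : ∀ {x} → closed? (close st v) x ≡ true → x ∉ Vg
      closed∉goal c with closed-after-close c
      ... | inj₁ refl = v∉Vg
      ... | inj₂ c′   = closed⇒∉goal c′

  ∈-successors⁻ : ∀ {v s} → s ∈ˡ successors v → Edge G v s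
  ∈-successors⁻ {v} {s} s∈
    with Θ v s | proj₂ (∈-filter⁻ (λ s → T? (is-just (Θ v s))) {xs = allFin n} s∈)
  ... | just θs | _ = θs , refl

  ∈-successors⁺ : ∀ {v s} → Edge G v s → s ∈ˡ successors v
  ∈-successors⁺ {v} {s} (θs , Θvs≡) =
    ∈-filter⁺ (λ s → T? (is-just (Θ v s))) (∈-allFin s) (subst (T ∘ is-just) (sym Θvs≡) tt)

  start-expansion : ∀ {st v q order} → SelectInv st → MinOpen st v → g st v ≡ fin q → v ∉ Vg →
                    order ↭ successors v → ExpandInv (close st v) v q order
  start-expansion {st} {v} {q} {order} S (ov , min) key v∉Vg order↭ = record
    { wf             = close-wf wf ov v∉Vg
    ; key            = key
    ; expanded       = update-same v true (closed? st)
    ; closed≤key     = closed≤key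
    ; key≤open       = λ {x} o → subst (_≤∞ g st x) key (min x (proj₂ (open-after-close o)))
    ; closed-relaxed = relaxed
    ; pending-edge   = λ s∈ → ∈-successors⁻ (∈-resp-↭ order↭ s∈) }
    where
    open SelectInv S
    open Closing st v
    closed≤key : ∀ {w} → closed? (close st v) w ≡ true → g st w ≤∞ fin q
    closed≤key {w} c with closed-after-close c
    ... | inj₁ refl = subst (_≤∞ fin q) (sym key) ≤∞-refl
    ... | inj₂ c′   = subst (g st w ≤∞_) key (closed≤open c′ ov)
    relaxed : ∀ {w s} → closed? (close st v) w ≡ true → Edge G w s →
              w ≡ v × s ∈ˡ order ⊎ Relaxed st w s
    relaxed c ws with closed-after-close c
    ... | inj₁ refl = inj₁ (refl , ∈-resp-↭ (↭-sym order↭) (∈-successors⁺ ws))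
    ... | inj₂ c′   = inj₂ (closed-relaxed c′ ws)

  finish-expansion : ∀ {st v q} → ExpandInv st v q [] → SelectInv st
  finish-expansion {st} {v} E = record
    { wf             = wf
    ; closed≤open    = λ c o → ≤∞-trans (closed≤key c) (key≤open o)
    ; closed-relaxed = λ c ws → relaxed (closed-relaxed c ws) }
    where
    open ExpandInv E
    relaxed : ∀ {w s} → w ≡ v × s ∈ˡ [] ⊎ Relaxed st w s → Relaxed st w s
    relaxed (inj₂ r) = r

  -- Relaxing a successor

  Agree : State → State → Fin n → Set
  Agree st st′ x = open? st′ x ≡ open? st x × g st′ x ≡ g st x × parent st′ x ≡ parent st x

  record Lowered (st st′ : State) (v s : Fin n) : Set where
    field
      opened   : open? st′ s ≡ true
      lowered  : g st′ s ≡ g st v ⊕ uΘ G v s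
      adopted  : parent st′ s ≡ just v
      improves : Improves (g st v ⊕ uΘ G v s) (g st s)
      unclosed : closed? st s ≡ false

  record Relaxation (st st′ : State) (v s : Fin n) : Set where
    field
      same-closed  : ∀ x → closed? st′ x ≡ closed? st x
      others-agree : ∀ {x} → x ≢ s → Agree st st′ x
      at-s         : Agree st st′ s × Relaxed st v s ⊎ Lowered st st′ v s

  module _ {st st′ v s} (R : Relaxation st st′ v s) where
    open Relaxation R
    open Lowered

    agree-or-lowered : ∀ x → Agree st st′ x ⊎ x ≡ s × Lowered st st′ v s
    agree-or-lowered x with x ≟ s | at-s
    ... | no x≢s   | _                = inj₁ (others-agree x≢s)
    ... | yes refl | inj₁ (agree , _) = inj₁ agree
    ... | yes refl | inj₂ L           = inj₂ (refl , L)

    closed-before : ∀ {x} → closed? st′ x ≡ true → closed? st x ≡ true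
    closed-before {x} c = trans (sym (same-closed x)) c

    closed⇒agree : ∀ {x} → closed? st x ≡ true → Agree st st′ x
    closed⇒agree {x} c with agree-or-lowered x
    ... | inj₁ agree      = agree
    ... | inj₂ (refl , L) = ⊥-elim (not-¬ c (unclosed L))

    closed-key : ∀ {x} → closed? st x ≡ true → g st′ x ≡ g st x
    closed-key c = proj₁ (proj₂ (closed⇒agree c))

    closed-parent : ∀ {x} → closed? st x ≡ true → parent st′ x ≡ parent st x
    closed-parent c = proj₂ (proj₂ (closed⇒agree c))

    key-decreases : ∀ x → g st′ x ≤∞ g st x
    key-decreases x with agree-or-lowered x
    ... | inj₁ (_ , g≡ , _) = ≤∞-reflexive g≡
    ... | inj₂ (refl , L)   = subst (_≤∞ g st s) (sym (lowered L)) (<∞⇒≤∞ (proj₁ (improves L)))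

    module _ (cv : closed? st v ≡ true) where

      relaxed-after : Relaxed st′ v s
      relaxed-after with at-s
      ... | inj₁ ((_ , gs≡ , _) , relaxed) =
        subst₂ (λ x y → ¬ Improves (x ⊕ uΘ G v s) y) (sym (closed-key cv)) (sym gs≡) relaxed
      ... | inj₂ L = λ (lt , _) →
        <∞⇒≱∞ lt (≤∞-reflexive (trans (lowered L) (cong (_⊕ uΘ G v s) (sym (closed-key cv)))))

      relaxation-wf : WellFormed st → Edge G v s → WellFormed st′
      relaxation-wf W vs-edge = record
        { open⇒¬closed   = open⇒¬closed′
        ; visited⇒finite = visited⇒finite′
        ; unvisited⇒∞    = unvisited⇒∞′
        ; nonneg         = nonneg′
        ; start-key      = start-key′
        ; parent-link    = parent-link′
        ; closed⇒∉goal   = closed⇒∉goal ∘ closed-before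
        ; visited⇒trace  = visited⇒trace′ }
        where
        open WellFormed W
        U≥0 : 0ℚ ≤ uΘ G v s
        U≥0 = uΘ-nonneg G vs-edge

        visited-before : ∀ {x} → Agree st st′ x → Visited st′ x → Visited st x
        visited-before (o≡ , _) (inj₁ o) = inj₁ (trans (sym o≡) o)
        visited-before _        (inj₂ c) = inj₂ (closed-before c)

        s≢vs : Lowered st st′ v s → s ≢ vs
        s≢vs L refl = <∞⇒≱∞ (proj₁ (improves L))
          (≤∞-trans (≤∞-reflexive start-key) (≤∞-trans (nonneg v) (x≤∞x⊕q _ U≥0)))

        parents-kept : ∀ {x y} → parent st x ≡ just y → parent st′ y ≡ parent st y
        parents-kept par≡ = closed-parent (proj₁ (parent-link par≡))

        open⇒¬closed′ : ∀ {x} → open? st′ x ≡ true → closed? st′ x ≡ false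
        open⇒¬closed′ {x} o with agree-or-lowered x
        ... | inj₁ (o≡ , _) = trans (same-closed x) (open⇒¬closed (trans (sym o≡) o))
        ... | inj₂ (refl , L) = trans (same-closed s) (unclosed L)

        visited⇒finite′ : ∀ {x} → Visited st′ x → ∃ λ q → g st′ x ≡ fin q
        visited⇒finite′ {x} vis with agree-or-lowered x
        ... | inj₁ A@(_ , g≡ , _) = let q , g≡q = visited⇒finite (visited-before A vis) in q , trans g≡ g≡q
        ... | inj₂ (refl , L)     = let q , g≡q = visited⇒finite (inj₂ cv) in
                                    q + uΘ G v s , trans (lowered L) (cong (_⊕ uΘ G v s) g≡q)

        unvisited⇒∞′ : ∀ {x} → open? st′ x ≡ false → closed? st′ x ≡ false → g st′ x ≡ ∞
        unvisited⇒∞′ {x} o c with agree-or-lowered x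
        ... | inj₁ (o≡ , g≡ , _) =
          trans g≡ (unvisited⇒∞ (trans (sym o≡) o) (trans (sym (same-closed x)) c))
        ... | inj₂ (refl , L)    = ⊥-elim (not-¬ (opened L) o)

        nonneg′ : ∀ x → fin 0ℚ ≤∞ g st′ x
        nonneg′ x with agree-or-lowered x
        ... | inj₁ (_ , g≡ , _) = subst (fin 0ℚ ≤∞_) (sym g≡) (nonneg x)
        ... | inj₂ (refl , L)   =
          subst (fin 0ℚ ≤∞_) (sym (lowered L)) (≤∞-trans (nonneg v) (x≤∞x⊕q _ U≥0))

        start-key′ : g st′ vs ≡ fin 0ℚ
        start-key′ with agree-or-lowered vs
        ... | inj₁ (_ , g≡ , _) = trans g≡ start-key
        ... | inj₂ (refl , L)   = ⊥-elim (s≢vs L refl)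

        parent-link′ : ∀ {x y} → parent st′ x ≡ just y → ParentLink st′ y x
        parent-link′ {x} {y} par≡ with agree-or-lowered x
        ... | inj₁ (_ , g≡ , p≡) =
          let cy , yx , link = parent-link (trans (sym p≡) par≡) in
          trans (same-closed y) cy , yx ,
          subst₂ (λ a b → a ⊕ uΘ G y x ≤∞ b) (sym (closed-key cy)) (sym g≡) link
        ... | inj₂ (refl , L) with just-injective (trans (sym (adopted L)) par≡)
        ...   | refl = trans (same-closed v) cv , vs-edge ,
                       ≤∞-reflexive (trans (cong (_⊕ uΘ G v s) (closed-key cv)) (sym (lowered L)))

        visited⇒trace′ : ∀ {x} → Visited st′ x → ∃ (Trace (parent st′) x)
        visited⇒trace′ {x} vis with agree-or-lowered x
        ... | inj₁ A@(_ , _ , p≡) = let π , tr = visited⇒trace (visited-before A vis) in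
                                    π , Trace-transfer parents-kept p≡ tr
        ... | inj₂ (refl , L)     = let π , tr = visited⇒trace (inj₂ cv) in
                                    π ∷ʳ s , via (s≢vs L) (adopted L)
                                               (Trace-transfer parents-kept (closed-parent cv) tr)

  relaxation-inv : ∀ {st st′ v q s order} → ExpandInv st v q (s ∷ order) → Relaxation st st′ v s →
                   ExpandInv st′ v q order
  relaxation-inv {st} {st′} {v} {q} {s} {order} E R = record
    { wf             = relaxation-wf R expanded wf (pending-edge (here refl))
    ; key            = trans (closed-key R expanded) key
    ; expanded       = trans (same-closed v) expanded
    ; closed≤key     = λ c → let c′ = closed-before R c in
                             subst (_≤∞ fin q) (sym (closed-key R c′)) (closed≤key c′)
    ; key≤open       = key≤open′
    ; closed-relaxed = closed-relaxed′
    ; pending-edge   = pending-edge ∘ there }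
    where
    open ExpandInv E
    open Relaxation R using (same-closed)

    key≤open′ : ∀ {x} → open? st′ x ≡ true → fin q ≤∞ g st′ x
    key≤open′ {x} o with agree-or-lowered R x
    ... | inj₁ (o≡ , g≡ , _) = subst (fin q ≤∞_) (sym g≡) (key≤open (trans (sym o≡) o))
    ... | inj₂ (refl , L)    =
      subst (fin q ≤∞_) (sym (trans (Lowered.lowered L) (cong (_⊕ uΘ G v s) key)))
        (x≤∞x⊕q (fin q) (uΘ-nonneg G (pending-edge (here refl))))

    closed-relaxed′ : ∀ {w t} → closed? st′ w ≡ true → Edge G w t →
                      w ≡ v × t ∈ˡ order ⊎ Relaxed st′ w t
    closed-relaxed′ {w} {t} c wt with closed-relaxed (closed-before R c) wt
    ... | inj₁ (refl , here refl) = inj₂ (relaxed-after R expanded)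
    ... | inj₁ (refl , there t∈)  = inj₁ (refl , t∈)
    ... | inj₂ relaxed            = inj₂ λ imp → relaxed (improves-≤∞
            (subst (λ z → Improves (z ⊕ uΘ G w t) (g st′ t)) (closed-key R (closed-before R c)) imp)
            (key-decreases R t))

  process-relaxation : ∀ {st v q s order} → ExpandInv st v q (s ∷ order) →
                       Relaxation st (process st v q s) v s
  process-relaxation {st} {v} {q} {s} E = accept? (improves-reflects (fin (q + ue)) gs)
    where
    open ExpandInv E
    -- the let-bound values and the two branches of BEAST.process
    gs : ℚ∞
    gs = if open? st s ∨ closed? st s then g st s else ∞
    ue : ℚ
    ue = maybe (λ θs → refine q gs 0ℚ 0ℚ (toList θs)) 0ℚ (Θ v s)
    g₀ : Fin n → ℚ∞
    g₀ = update s gs (g st)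
    U : ℚ
    U = uΘ G v s

    accepted : State
    accepted = record st { open? = update s true (open? st) ; g = update s (fin (q + ue)) g₀
                         ; parent = update s (just v) (parent st) }

    rejected : State
    rejected = record st { g = g₀ }

    gs≡ : gs ≡ g st s
    gs≡ = effective-key wf s

    key⊕U : g st v ⊕ U ≡ fin (q + U)
    key⊕U = cong (_⊕ U) key

    q≤key⊕U : fin q ≤∞ g st v ⊕ U
    q≤key⊕U = subst (fin q ≤∞_) (sym key⊕U) (x≤∞x⊕q (fin q) (uΘ-nonneg G (pending-edge (here refl))))

    verdict : SameVerdict q gs U ue
    verdict = edge-verdict q gs (pending-edge (here refl))

    accept : Improves (fin (q + ue)) gs → Relaxation st accepted v s
    accept imp = record
      { same-closed  = λ _ → refl
      ; others-agree = λ x≢s → update-other true (open? st) x≢s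
                             , trans (update-other (fin (q + ue)) g₀ x≢s) (update-other gs (g st) x≢s)
                             , update-other (just v) (parent st) x≢s
      ; at-s         = inj₂ record
        { opened   = update-same s true (open? st)
        ; lowered  = trans (update-same s (fin (q + ue)) g₀) new-key
        ; adopted  = update-same s (just v) (parent st)
        ; improves = improves
        ; unclosed = ¬-not λ cs → <∞⇒≱∞ (proj₁ improves) (≤∞-trans (closed≤key cs) q≤key⊕U) } }
      where
      ue≡U : ue ≡ U
      ue≡U with verdict
      ... | inj₁ ue≡U       = ue≡U
      ... | inj₂ (¬imp , _) = ⊥-elim (¬imp imp)
      new-key : fin (q + ue) ≡ g st v ⊕ U
      new-key = trans (cong (λ u → fin (q + u)) ue≡U) (sym key⊕U)
      improves : Improves (g st v ⊕ U) (g st s)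
      improves = subst₂ Improves new-key gs≡ imp

    reject : ¬ Improves (fin (q + ue)) gs → Relaxation st rejected v s
    reject ¬imp = record
      { same-closed  = λ _ → refl
      ; others-agree = λ x≢s → refl , update-other gs (g st) x≢s , refl
      ; at-s         = inj₁ ((refl , trans (update-same s gs (g st)) gs≡ , refl) ,
                             λ imp → ¬imp-U (subst₂ Improves key⊕U (sym gs≡) imp)) }
      where
      ¬imp-U : ¬ Improves (fin (q + U)) gs
      ¬imp-U with verdict
      ... | inj₁ ue≡U         = subst (λ u → ¬ Improves (fin (q + u)) gs) ue≡U ¬imp
      ... | inj₂ (_ , ¬imp-U) = ¬imp-U

    accept? : ∀ {b} → Reflects (Improves (fin (q + ue)) gs) b →
              Relaxation st (if b then accepted else rejected) v s
    accept? (ofʸ imp)  = accept imp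
    accept? (ofⁿ ¬imp) = reject ¬imp

  -- Termination and progress

  closedSet : State → Subset n
  closedSet st = tabulate (closed? st)

  module _ {st : State} {x : Fin n} where

    ∈-closedSet⁺ : closed? st x ≡ true → x ∈ closedSet st
    ∈-closedSet⁺ c = lookup⇒[]= x _ (trans (lookup∘tabulate (closed? st) x) c)

    ∈-closedSet⁻ : x ∈ closedSet st → closed? st x ≡ true
    ∈-closedSet⁻ x∈ = trans (sym (lookup∘tabulate (closed? st) x)) ([]=⇒lookup x∈)

  close-⊃ : ∀ {st v} → closed? st v ≡ false → closedSet (close st v) ⊃ closedSet st
  close-⊃ {st} {v} cv =
    (λ x∈ → ∈-closedSet⁺ {close st v} (Closing.closed-before-close st v (∈-closedSet⁻ {st} x∈))) ,
    v , ∈-closedSet⁺ {close st v} (update-same v true (closed? st)) ,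
    λ v∈ → not-¬ (∈-closedSet⁻ {st} v∈) cv

  done-acc : ∀ {out} → Acc (flip _⟶_) (done out)
  done-acc = acc λ ()

  mutual
    select-acc : ∀ {st C} → Acc _⊃_ C → closedSet st ≡ C → SelectInv st → Acc (flip _⟶_) (select st)
    select-acc {st} (acc rec) refl S = acc λ where
      (pop-goal _ _ _ _) → done-acc
      (fail _)           → done-acc
      (pop-expand {v = v} (ov , min) gv v∉Vg order↭) →
        expand-acc (rec (close-⊃ {st} {v} (WellFormed.open⇒¬closed (SelectInv.wf S) ov))) refl
                   (start-expansion S (ov , min) gv v∉Vg order↭)

    expand-acc : ∀ {st v q pending C} → Acc _⊃_ C → closedSet st ≡ C → ExpandInv st v q pending →
                 Acc (flip _⟶_) (expand st v q pending)
    expand-acc a refl E = acc λ where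
      end-expand → select-acc a refl (finish-expansion E)
      step       → let R = process-relaxation E in
                   expand-acc a (tabulate-cong (Relaxation.same-closed R)) (relaxation-inv E R)

  terminates : Acc (flip _⟶_) initial
  terminates = select-acc (⊃-wellFounded _) refl initial-inv

  select-progress : ∀ {st} → SelectInv st → ∃ (select st ⟶_)
  select-progress {st} S with argmin-or-empty (λ w → open? st w Bool.≟ true) (g st)
  ... | inj₁ none           = _ , fail (λ w → ¬-not (none w))
  ... | inj₂ (v , ov , min) = pop (visited⇒finite (inj₁ ov)) (v ∈? Vg)
    where
    open WellFormed (SelectInv.wf S)
    pop : ∃ (λ q → g st v ≡ fin q) → Dec (v ∈ Vg) → ∃ (select st ⟶_)
    pop (_ , gv) (yes v∈Vg) = _ , pop-goal (ov , min) gv v∈Vg (proj₂ (visited⇒trace (inj₁ ov)))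
    pop (_ , gv) (no  v∉Vg) = _ , pop-expand {order = successors v} (ov , min) gv v∉Vg ↭-refl

  -- Optimality of the returned path

  -- Dijkstra's argument: a closed node passes its key bound on along a relaxed edge, so walking
  -- along the path we meet an open node before the goal, which is never closed.
  open-below-path : ∀ {st} → SelectInv st → ∀ {a x π} → PathFromTo G a x π → x ∈ Vg → ∀ p →
                    g st a ≤∞ fin p → fin (p + uΘpath G π) ≤∞ uprune →
                    ∃ λ y → open? st y ≡ true × g st y ≤∞ fin (p + uΘpath G π)
  open-below-path S {a} path x∈Vg p a≤p bound with ≤fin⇒visited (SelectInv.wf S) a≤p
  ... | inj₁ oa = a , oa , ≤∞-trans a≤p (fin≤fin (p≤p+q p (uΘpath-nonneg G path)))
  open-below-path S (single _) x∈Vg p a≤p bound | inj₂ ca =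
    ⊥-elim (WellFormed.closed⇒∉goal (SelectInv.wf S) ca x∈Vg)
  open-below-path {st} S (cons {a} {b} {_} {π} ab path) x∈Vg p a≤p bound | inj₂ ca =
    let y , oy , y≤ = open-below-path S path x∈Vg (p + uΘ G a b) b≤ bound′ in
    y , oy , subst (λ z → g st y ≤∞ fin z) (sym cost≡) y≤
    where
    cost≡ : p + uΘpath G (a ∷ π) ≡ p + uΘ G a b + uΘpath G π
    cost≡ = trans (cong (p +_) (uΘpath-∷ G path)) (sym (+-assoc p (uΘ G a b) (uΘpath G π)))
    bound′ : fin (p + uΘ G a b + uΘpath G π) ≤∞ uprune
    bound′ = subst (λ z → fin z ≤∞ uprune) cost≡ bound
    a⊕ab≤ : g st a ⊕ uΘ G a b ≤∞ fin (p + uΘ G a b)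
    a⊕ab≤ = ⊕-monoˡ-≤∞ (uΘ G a b) a≤p
    b≤ : g st b ≤∞ fin (p + uΘ G a b)
    b≤ = ≤∞-trans (¬improves⇒≥∞ (SelectInv.closed-relaxed S ca ab)
                    (≤∞-trans a⊕ab≤ (≤∞-trans (x≤∞x⊕q _ (uΘpath-nonneg G path)) bound′)))
                  a⊕ab≤

  open-below-solution : ∀ {st π} → SelectInv st → Solution G vs Vg π → fin (uΘpath G π) ≤∞ uprune →
                        ∃ λ y → open? st y ≡ true × g st y ≤∞ fin (uΘpath G π)
  open-below-solution {st} {π} S (_ , path , x∈Vg) bound =
    let y , oy , y≤ = open-below-path S path x∈Vg 0ℚ
                        (≤∞-reflexive (WellFormed.start-key (SelectInv.wf S)))
                        (subst (λ c → fin c ≤∞ uprune) (sym (+-identityˡ (uΘpath G π))) bound) in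
    y , oy , subst (λ c → g st y ≤∞ fin c) (+-identityˡ (uΘpath G π)) y≤

  module Correctness (Ustar : ℚ∞) (isU : IsUStar G vs Vg Ustar) (U≤prune : Ustar ≤∞ uprune) where

    Correct : Output → Set
    Correct (π , U) =
        ((∃[ π′ ] (Solution G vs Vg π′)) → Solution G vs Vg π × fin (uΘpath G π) ≡ Ustar × U ≡ Ustar)
      × ((∀ π′ → ¬ Solution G vs Vg π′) → π ≡ [] × U ≡ ∞)

    optimum : ∃[ π′ ] (Solution G vs Vg π′) →
              ∃[ π* ] (Solution G vs Vg π* × Ustar ≡ fin (uΘpath G π*) ×
                       (∀ π′ → Solution G vs Vg π′ → uΘpath G π* ≤ uΘpath G π′))
    optimum (π′ , sol) = [ id , (λ (_ , none) → ⊥-elim (none π′ sol)) ]′ isU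

    goal-correct : ∀ {st v q π} → SelectInv st → MinOpen st v → g st v ≡ fin q → v ∈ Vg →
                   Trace (parent st) v π → Correct (π , fin q)
    goal-correct {st} {v} {q} {π} S (_ , min) gv v∈Vg tr = optimal , λ none → ⊥-elim (none π solution)
      where
      path : PathFromTo G vs v π × fin (uΘpath G π) ≤∞ g st v
      path = trace-path (SelectInv.wf S) tr
      solution : Solution G vs Vg π
      solution = v , proj₁ path , v∈Vg
      π≤q : uΘpath G π ≤ q
      π≤q = fin-≤⁻ (subst (fin (uΘpath G π) ≤∞_) gv (proj₂ path))
      optimal : ∃[ π′ ] (Solution G vs Vg π′) →
                Solution G vs Vg π × fin (uΘpath G π) ≡ Ustar × fin q ≡ Ustar
      optimal ∃sol =
        let π* , sol* , U≡ , least = optimum ∃sol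
            y , oy , y≤ = open-below-solution S sol* (subst (_≤∞ uprune) U≡ U≤prune)
            q≤* = fin-≤⁻ (subst (_≤∞ fin (uΘpath G π*)) gv (≤∞-trans (min y oy) y≤))
            *≤π = least π solution
        in solution ,
           trans (cong fin (≤-antisym (≤-trans π≤q q≤*) *≤π)) (sym U≡) ,
           trans (cong fin (≤-antisym q≤* (≤-trans *≤π π≤q))) (sym U≡)

    fail-correct : ∀ {st} → SelectInv st → (∀ w → open? st w ≡ false) → Correct ([] , ∞)
    fail-correct S none = no-solution , λ _ → refl , refl
      where
      no-solution : ∃[ π′ ] (Solution G vs Vg π′) →
                    Solution G vs Vg [] × fin (uΘpath G []) ≡ Ustar × ∞ ≡ Ustar
      no-solution ∃sol =
        let _ , sol* , U≡ , _ = optimum ∃sol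
            y , oy , _ = open-below-solution S sol* (subst (_≤∞ uprune) U≡ U≤prune)
        in ⊥-elim (not-¬ oy (none y))

    Inv : Config → Set
    Inv (select st)             = SelectInv st
    Inv (expand st v q pending) = ExpandInv st v q pending
    Inv (done out)              = Correct out

    preserves : ∀ {c c′} → Inv c → c ⟶ c′ → Inv c′
    preserves S (pop-goal min gv v∈Vg tr)      = goal-correct S min gv v∈Vg tr
    preserves S (pop-expand min gv v∉Vg order↭) = start-expansion S min gv v∉Vg order↭
    preserves E step                            = relaxation-inv E (process-relaxation E)
    preserves E end-expand                      = finish-expansion E
    preserves S (fail none)                     = fail-correct S none

    reachable : ∀ {c} → Star _⟶_ initial c → Inv c
    reachable run = fold (λ c c′ → Inv c → Inv c′) (λ r inv → inv ∘ flip preserves r) id run initial-inv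

    progress : ∀ c → Inv c → ∃[ out ] (c ≡ done out) ⊎ ∃[ c′ ] (c ⟶ c′)
    progress (select _)             S = inj₂ (select-progress S)
    progress (expand _ _ _ (_ ∷ _)) _ = inj₂ (_ , step)
    progress (expand _ _ _ [])      _ = inj₂ (_ , end-expand)
    progress (done out)             _ = inj₁ (out , refl)

theorem3 : ∀ {n : ℕ} (G : EWDG n) (vs : Fin n) (Vg : Subset n) (uprune Ustar : ℚ∞) →
    IsUStar G vs Vg Ustar → Ustar ≤∞ uprune →
    -- every run of BEAST terminates ...
    Acc (flip (BEAST._⟶_ G vs Vg uprune)) (BEAST.initial G vs Vg uprune)
    -- ... never gets stuck before returning ...
    × (∀ c → Star (BEAST._⟶_ G vs Vg uprune) (BEAST.initial G vs Vg uprune) c →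
         (∃[ out ] (c ≡ BEAST.done out)) ⊎ (∃[ c' ] (BEAST._⟶_ G vs Vg uprune c c')))
    -- ... and whatever it returns is correct
    × (∀ π U → Star (BEAST._⟶_ G vs Vg uprune) (BEAST.initial G vs Vg uprune) (BEAST.done (π , U)) →
         ((∃[ π' ] (Solution G vs Vg π')) →
            Solution G vs Vg π × fin (uΘpath G π) ≡ Ustar × U ≡ Ustar)
       × ((∀ π' → ¬ Solution G vs Vg π') → π ≡ [] × U ≡ ∞))
theorem3 G vs Vg uprune Ustar isU U≤prune =
  terminates , (λ c run → progress c (reachable run)) , (λ π U run → reachable run)
  where
  open BEAST-Properties G vs Vg uprune
  open Correctness Ustar isU U≤prune
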